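{- Let $\mathcal{B}$ be a finite relational structure with domain $B$, let $b\in B$, and suppose the shop $\forall_b$ is a she of $\mathcal{B}$. Let $\varphi(u,\mathbf{v})$ be a formula of $\{\exists,\forall,\wedge,\vee\}$-FO with free variables among $u$ and the tuple $\mathbf{v}=(v_1,\dots,v_k)$. Then for all $\mathbf{x}\in B^k$, $\mathcal{B}\models\forall u\,\varphi(u,\mathbf{x})$ if and only if $\mathcal{B}\models\varphi(b,\mathbf{x})$.
   Context: $\{\exists,\forall,\wedge,\vee\}$-FO is the set of first-order formulas over the signature of $\mathcal{B}$ built from relational atoms using only $\wedge,\vee,\exists,\forall$ (no equality, no negation). A shop on $B$ is a map $f:B\to\mathfrak{P}(B)\setminus\{\emptyset\}$ with every $y\in B$ in some $f(x)$; a she of $\mathcal{B}$ is a shop $f$ such that for each relation $R$ of $\mathcal{B}$, $\mathcal{B}\models R(x_1,\dots,x_i)$ implies $\mathcal{B}\models R(y_1,\dots,y_i)$ for all $y_j\in f(x_j)$. The shop $\forall_b$ is defined by $\forall_b(b)=B$ and $\forall_b(x)=\{x\}$ for $x\neq b$. -}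

module Defs where

open import Data.Nat using (ℕ; suc)
open import Data.Fin using (Fin; zero; suc)
open import Data.Product using (_×_; Σ; ∃)
open import Data.Sum using (_⊎_)
open import Relation.Binary.PropositionalEquality using (_≡_)

record Structure : Set₁ where
  field
    size  : ℕ
    nrel  : ℕ
    arity : Fin nrel → ℕ
    rel   : (i : Fin nrel) → (Fin (arity i) → Fin size) → Set

module _ (𝔅 : Structure) where
  open Structure 𝔅

  Dom : Set
  Dom = Fin size

  data Formula (m : ℕ) : Set where
    atom : (i : Fin nrel) → (Fin (arity i) → Fin m) → Formula m
    _∧'_ : Formula m → Formula m → Formula m
    _∨'_ : Formula m → Formula m → Formula m
    ∃'   : Formula (suc m) → Formula m
    ∀'   : Formula (suc m) → Formula m

  _▸_ : ∀ {m} → Dom → (Fin m → Dom) → (Fin (suc m) → Dom)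
  (a ▸ ρ) zero    = a
  (a ▸ ρ) (suc j) = ρ j

  _⊨_[_] : ∀ {m} → Formula m → (Fin m → Dom) → Set
  _⊨_[_] (atom i ts) ρ = rel i (λ j → ρ (ts j))
  _⊨_[_] (φ ∧' ψ) ρ = _⊨_[_] φ ρ × _⊨_[_] ψ ρ
  _⊨_[_] (φ ∨' ψ) ρ = _⊨_[_] φ ρ ⊎ _⊨_[_] ψ ρ
  _⊨_[_] (∃' φ) ρ = Σ Dom (λ a → _⊨_[_] φ (a ▸ ρ))
  _⊨_[_] (∀' φ) ρ = (a : Dom) → _⊨_[_] φ (a ▸ ρ)

  -- A map f : B → 𝔓(B), represented by its membership relation  y ∈ f(x)  ↔  f x y
  ShopMap : Set₁
  ShopMap = Dom → Dom → Set

  IsShop : ShopMap → Set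
  IsShop f = ((x : Dom) → ∃ (λ y → f x y)) × ((y : Dom) → ∃ (λ x → f x y))

  IsShe : ShopMap → Set
  IsShe f = IsShop f ×
    ((i : Fin nrel) (xs ys : Fin (arity i) → Dom) →
       rel i xs → ((j : Fin (arity i)) → f (xs j) (ys j)) → rel i ys)

  -- the shop ∀_b : ∀_b(b) = B, ∀_b(x) = {x} for x ≠ b
  -- (y ∈ ∀_b(x)  iff  x = b or y = x)
  forallShop : Dom → ShopMap
  forallShop b x y = (x ≡ b) ⊎ (y ≡ x)

-- Positive formulas are preserved along any relation-preserving multimap f
-- containing the diagonal.  Under ∀_b, the value b may be replaced by any
-- element while all other values stay fixed, so φ(b, x) propagates to every φ(a, x).
module Submission where

open import Defs
open import Data.Nat using (ℕ; suc)
open import Data.Fin using (Fin; zero; suc)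
open import Function.Bundles using (_⇔_; mk⇔)
open import Data.Product using (_,_; proj₂)
open import Data.Sum using (inj₁; inj₂)
open import Relation.Binary.PropositionalEquality using (refl)

module _ (𝔅 : Structure) where
  open Structure 𝔅 using (nrel; arity; rel)

  PreservesRelations : ShopMap 𝔅 → Set
  PreservesRelations f =
    (i : Fin nrel) (xs ys : Fin (arity i) → Dom 𝔅) →
    rel i xs → ((j : Fin (arity i)) → f (xs j) (ys j)) → rel i ys

  Reflexive : ShopMap 𝔅 → Set
  Reflexive f = (a : Dom 𝔅) → f a a

  Pointwise : ∀ {m} → ShopMap 𝔅 → (ρ σ : Fin m → Dom 𝔅) → Set
  Pointwise f ρ σ = ∀ j → f (ρ j) (σ j)

  she⇒preservesRelations : ∀ {f} → IsShe 𝔅 f → PreservesRelations f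
  she⇒preservesRelations = proj₂

  forallShop-reflexive : ∀ b → Reflexive (forallShop 𝔅 b)
  forallShop-reflexive b a = inj₂ refl

  module _ {f : ShopMap 𝔅} (refl-f : Reflexive f) (pres-f : PreservesRelations f) where

    Pointwise-▸ : ∀ {m} (a : Dom 𝔅) {ρ σ : Fin m → Dom 𝔅} →
                  Pointwise f ρ σ → Pointwise f (_▸_ 𝔅 a ρ) (_▸_ 𝔅 a σ)
    Pointwise-▸ a ρfσ zero    = refl-f a
    Pointwise-▸ a ρfσ (suc j) = ρfσ j

    ⊨-preserved : ∀ {m} (ψ : Formula 𝔅 m) {ρ σ : Fin m → Dom 𝔅} →
                  Pointwise f ρ σ → _⊨_[_] 𝔅 ψ ρ → _⊨_[_] 𝔅 ψ σ
    ⊨-preserved (atom i ts) ρfσ h          = pres-f i _ _ h (λ j → ρfσ (ts j))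
    ⊨-preserved (ψ ∧' χ)    ρfσ (hψ , hχ)  = ⊨-preserved ψ ρfσ hψ , ⊨-preserved χ ρfσ hχ
    ⊨-preserved (ψ ∨' χ)    ρfσ (inj₁ hψ)  = inj₁ (⊨-preserved ψ ρfσ hψ)
    ⊨-preserved (ψ ∨' χ)    ρfσ (inj₂ hχ)  = inj₂ (⊨-preserved χ ρfσ hχ)
    ⊨-preserved (∃' ψ)      ρfσ (a , h)    = a , ⊨-preserved ψ (Pointwise-▸ a ρfσ) h
    ⊨-preserved (∀' ψ)      ρfσ h a        = ⊨-preserved ψ (Pointwise-▸ a ρfσ) (h a)

  forallShop-▸ : ∀ {m} b a (x : Fin m → Dom 𝔅) →
                 Pointwise (forallShop 𝔅 b) (_▸_ 𝔅 b x) (_▸_ 𝔅 a x)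
  forallShop-▸ b a x zero    = inj₁ refl
  forallShop-▸ b a x (suc j) = inj₂ refl

lemma3p1 : (𝔅 : Structure) (b : Dom 𝔅) → IsShe 𝔅 (forallShop 𝔅 b) →
    (k : ℕ) (φ : Formula 𝔅 (suc k)) (x : Fin k → Dom 𝔅) →
    (_⊨_[_] 𝔅 (∀' φ) x) ⇔ (_⊨_[_] 𝔅 φ (_▸_ 𝔅 b x))
lemma3p1 𝔅 b she k φ x = mk⇔ (λ ∀φ → ∀φ b) φb⇒∀φ
  where
  φb⇒∀φ : _⊨_[_] 𝔅 φ (_▸_ 𝔅 b x) → _⊨_[_] 𝔅 (∀' φ) x
  φb⇒∀φ φb a = ⊨-preserved 𝔅 {forallShop 𝔅 b} (forallShop-reflexive 𝔅 b) (she⇒preservesRelations 𝔅 she)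
                 φ (forallShop-▸ 𝔅 b a x) φb
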